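{- Let $p$ be an odd prime, $k=2p$, and $n=p^2-1$. Define $f:\{0,1,\ldots,n-1\}\to\{ -1,1\}$ by $f(j)=-1$ if $j\bmod k<p-1$ and $f(j)=1$ if $j\bmod k\ge p-1$ (where $j\bmod k\in\{0,\ldots,k-1\}$). Then every $k$-term arithmetic progression $A\subseteq\{0,1,\ldots,n-1\}$ with positive common difference satisfies $\sum_{j\in A}f(j)\ne0$. -}

module Defs where

open import Data.Nat using (ℕ; zero; suc; _*_; _∸_; _<ᵇ_; NonZero)
open import Data.Nat.Properties using (m*n≢0)
open import Data.Nat.DivMod using (_%_)
open import Data.Integer using (ℤ; +_; -_; _+_)
open import Data.Bool using (if_then_else_)

f : (p : ℕ) → .{{NonZero p}} → ℕ → ℤ
f p j = if (j % (2 * p)) <ᵇ (p ∸ 1) then - (+ 1) else + 1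
  where instance
    _ : NonZero (2 * p)
    _ = m*n≢0 2 p

sumTo : ℕ → (ℕ → ℤ) → ℤ
sumTo zero    g = + 0
sumTo (suc m) g = sumTo m g + g m

-- Split the progression into the pairs of terms i and i + p (i < p), whose
-- indices differ by p·d. If d is even, p·d is a multiple of the period 2p of f,
-- so the sum is twice a sum of p signs, and p is odd. If d is odd, the pair
-- indices differ by p modulo 2p, and f j + f (j + p) is 0 unless j ≡ p − 1
-- (mod p), where it is 2; as 0 < d < p is coprime to p, some a + i·d with i < p
-- lies in that residue class, so the sum is positive.
module Submission where

open import Defs
open import Data.Nat using (ℕ; _*_; _+_; _∸_; _<_; _≤_; _^_; NonZero)
open import Data.Nat.Primality using (Prime)
open import Data.Integer using (+_)
open import Relation.Binary.PropositionalEquality using (_≡_; _≢_)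

open import Data.Nat using (zero; suc; _<ᵇ_; z≤n; s≤s; s≤s⁻¹; _/_; _%_)
open import Data.Nat.Properties
open import Data.Nat.DivMod using (m≡m%n+[m/n]*n; [m+kn]%n≡m%n; m%n<n; m<n⇒m%n≡m; %-pred-≡0)
open import Data.Nat.Divisibility using (_∣_; divides; n∣m*n; ∣m+n∣m⇒∣n; n∣m⇒m%n≡0)
open import Data.Nat.Coprimality using (Coprime; prime⇒coprime; coprime-Bézout)
open import Data.Nat.GCD using (module Bézout)
open import Data.Nat.Primality using (prime⇒irreducible)
import Data.Nat.Tactic.RingSolver as ℕ-Solver
open import Data.Integer as ℤ using (ℤ; 0ℤ; 1ℤ; -1ℤ; -[1+_])
import Data.Integer.Properties as ℤ
import Data.Integer.Tactic.RingSolver as ℤ-Solver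
open import Algebra.Properties.CommutativeSemigroup ℤ.+-commutativeSemigroup using (interchange)
open import Data.Bool using (true; false; if_then_else_)
open import Data.Product using (∃-syntax; _×_; _,_)
open import Data.Sum using (_⊎_; inj₁; inj₂)
open import Data.List using (_∷_; [])
open import Relation.Nullary using (yes; no; contradiction; ofʸ)
open import Relation.Binary.PropositionalEquality using (refl; sym; trans; cong; cong₂; subst; module ≡-Reasoning)

even⊎odd : ∀ n → ∃[ e ] (n ≡ e * 2 ⊎ n ≡ suc (e * 2))
even⊎odd zero = 0 , inj₁ refl
even⊎odd (suc n) with even⊎odd n
... | e , inj₁ n≡2e   = e , inj₂ (cong suc n≡2e)
... | e , inj₂ n≡1+2e = suc e , inj₁ (cong suc n≡1+2e)

m≥n⇒m<ᵇn≡false : ∀ {m n} → n ≤ m → (m <ᵇ n) ≡ false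
m≥n⇒m<ᵇn≡false {m} {n} n≤m with m <ᵇ n | <ᵇ-reflects-< m n
... | false | _       = refl
... | true  | ofʸ m<n = contradiction m<n (≤⇒≯ n≤m)

n≤2n∸1 : ∀ n → n ≤ 2 * n ∸ 1
n≤2n∸1 zero    = z≤n
n≤2n∸1 (suc n) = ≤-trans (m≤n+m (suc n) n) (≤-reflexive (cong (λ x → n + suc x) (sym (+-identityʳ n))))

m+[2n∸1]*d<n^2∸1⇒d<n : ∀ m n d → m + (2 * n ∸ 1) * d < n ^ 2 ∸ 1 → d < n
m+[2n∸1]*d<n^2∸1⇒d<n m n d bound with d <? n
... | yes d<n = d<n
... | no  d≮n = contradiction bound (≤⇒≯ (begin
  n ^ 2 ∸ 1           ≤⟨ m∸n≤m (n ^ 2) 1 ⟩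
  n ^ 2               ≡⟨ cong (n *_) (*-identityʳ n) ⟩
  n * n               ≤⟨ *-mono-≤ (n≤2n∸1 n) (≮⇒≥ d≮n) ⟩
  (2 * n ∸ 1) * d     ≤⟨ m≤n+m _ m ⟩
  m + (2 * n ∸ 1) * d ∎))
  where open ≤-Reasoning

i+i≡0⇒i≡0 : ∀ {i} → i ℤ.+ i ≡ 0ℤ → i ≡ 0ℤ
i+i≡0⇒i≡0 {+ zero}    _  = refl
i+i≡0⇒i≡0 {+ suc n}   ()
i+i≡0⇒i≡0 { -[1+ n ]} ()

prime∧2∣p⇒p≡2 : ∀ {p} → Prime p → 2 ∣ p → p ≡ 2
prime∧2∣p⇒p≡2 pr 2∣p with prime⇒irreducible pr 2∣p
... | inj₁ ()
... | inj₂ 2≡p = sym 2≡p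

sumTo-cong : ∀ m {g h : ℕ → ℤ} → (∀ i → g i ≡ h i) → sumTo m g ≡ sumTo m h
sumTo-cong zero    g≗h = refl
sumTo-cong (suc m) g≗h = cong₂ ℤ._+_ (sumTo-cong m g≗h) (g≗h m)

sumTo-+ : ∀ m n g → sumTo (m + n) g ≡ sumTo m g ℤ.+ sumTo n (λ i → g (m + i))
sumTo-+ m zero    g rewrite +-identityʳ m = sym (ℤ.+-identityʳ _)
sumTo-+ m (suc n) g rewrite +-suc m n =
  trans (cong (ℤ._+ g (m + n)) (sumTo-+ m n g)) (ℤ.+-assoc (sumTo m g) _ _)

sumTo-distrib-+ : ∀ m g h → sumTo m (λ i → g i ℤ.+ h i) ≡ sumTo m g ℤ.+ sumTo m h
sumTo-distrib-+ zero    g h = refl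
sumTo-distrib-+ (suc m) g h =
  trans (cong (ℤ._+ (g m ℤ.+ h m)) (sumTo-distrib-+ m g h)) (interchange (sumTo m g) (sumTo m h) (g m) (h m))

sumTo-nonneg : ∀ m g → (∀ i → 0ℤ ℤ.≤ g i) → 0ℤ ℤ.≤ sumTo m g
sumTo-nonneg zero    g g≥0 = ℤ.≤-refl
sumTo-nonneg (suc m) g g≥0 = ℤ.+-mono-≤ (sumTo-nonneg m g g≥0) (g≥0 m)

sumTo-pos : ∀ m g → (∀ i → 0ℤ ℤ.≤ g i) → ∀ {j} → j < m → 0ℤ ℤ.< g j → 0ℤ ℤ.< sumTo m g
sumTo-pos (suc m) g g≥0 j<1+m gj>0 with m≤n⇒m<n∨m≡n (s≤s⁻¹ j<1+m)
... | inj₁ j<m  = ℤ.+-mono-<-≤ (sumTo-pos m g g≥0 j<m gj>0) (g≥0 m)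
... | inj₂ refl = ℤ.+-mono-≤-< (sumTo-nonneg m g g≥0) gj>0

sumTo-±1-parity : ∀ m g → (∀ i → g i ≡ -1ℤ ⊎ g i ≡ 1ℤ) → ∃[ k ] sumTo m g ℤ.+ (+ k ℤ.+ + k) ≡ + m
sumTo-±1-parity zero    g ±1 = 0 , refl
sumTo-±1-parity (suc m) g ±1 with sumTo-±1-parity m g ±1 | ±1 m
... | k , eq | inj₁ gm≡-1 = suc k , (begin
  (sumTo m g ℤ.+ g m) ℤ.+ (+ suc k ℤ.+ + suc k)   ≡⟨ cong (λ x → (sumTo m g ℤ.+ x) ℤ.+ (+ suc k ℤ.+ + suc k)) gm≡-1 ⟩
  (sumTo m g ℤ.+ -1ℤ) ℤ.+ (+ suc k ℤ.+ + suc k)   ≡⟨ regroup (sumTo m g) (+ k) ⟩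
  1ℤ ℤ.+ (sumTo m g ℤ.+ (+ k ℤ.+ + k))            ≡⟨ cong (ℤ._+_ 1ℤ) eq ⟩
  + suc m                                         ∎)
  where
  open ≡-Reasoning
  regroup : ∀ S K → (S ℤ.+ -1ℤ) ℤ.+ ((1ℤ ℤ.+ K) ℤ.+ (1ℤ ℤ.+ K)) ≡ 1ℤ ℤ.+ (S ℤ.+ (K ℤ.+ K))
  regroup = ℤ-Solver.solve-∀
... | k , eq | inj₂ gm≡1 = k , (begin
  (sumTo m g ℤ.+ g m) ℤ.+ (+ k ℤ.+ + k)           ≡⟨ cong (λ x → (sumTo m g ℤ.+ x) ℤ.+ (+ k ℤ.+ + k)) gm≡1 ⟩
  (sumTo m g ℤ.+ 1ℤ) ℤ.+ (+ k ℤ.+ + k)            ≡⟨ regroup (sumTo m g) (+ k) ⟩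
  1ℤ ℤ.+ (sumTo m g ℤ.+ (+ k ℤ.+ + k))            ≡⟨ cong (ℤ._+_ 1ℤ) eq ⟩
  + suc m                                         ∎)
  where
  open ≡-Reasoning
  regroup : ∀ S K → (S ℤ.+ 1ℤ) ℤ.+ (K ℤ.+ K) ≡ 1ℤ ℤ.+ (S ℤ.+ (K ℤ.+ K))
  regroup = ℤ-Solver.solve-∀

sumTo-±1≡0⇒2∣m : ∀ m g → (∀ i → g i ≡ -1ℤ ⊎ g i ≡ 1ℤ) → sumTo m g ≡ 0ℤ → 2 ∣ m
sumTo-±1≡0⇒2∣m m g ±1 sum≡0 with sumTo-±1-parity m g ±1
... | k , eq = divides k (begin
  m      ≡⟨ ℤ.+-injective (trans (cong (ℤ._+ (+ k ℤ.+ + k)) (sym sum≡0)) eq) ⟨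
  k + k  ≡⟨ ℕ-Solver.solve (k ∷ []) ⟩
  k * 2  ∎)
  where open ≡-Reasoning

-- Bézout gives y·d ≡ −1 or y·d ≡ 1 (mod n); take i = c·y, resp. i = c·(n − 1)·y.
coprime⇒∃i∣c+i*d : ∀ {n d} .{{_ : NonZero n}} → Coprime n d → ∀ c → ∃[ i ] n ∣ c + i * d
coprime⇒∃i∣c+i*d {suc q} {d} n⊥d c with coprime-Bézout n⊥d
... | Bézout.+- x y 1+yd≡xn = c * y , divides (c * x) (begin
  c + c * y * d       ≡⟨ ℕ-Solver.solve (c ∷ y ∷ d ∷ []) ⟩
  c * (1 + y * d)     ≡⟨ cong (c *_) 1+yd≡xn ⟩
  c * (x * suc q)     ≡⟨ *-assoc c x (suc q) ⟨
  c * x * suc q       ∎)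
  where open ≡-Reasoning
... | Bézout.-+ x y 1+xn≡yd = c * q * y , divides (c + c * q * x) (begin
  c + c * q * y * d          ≡⟨ ℕ-Solver.solve (c ∷ q ∷ y ∷ d ∷ []) ⟩
  c + c * q * (y * d)        ≡⟨ cong (λ z → c + c * q * z) 1+xn≡yd ⟨
  c + c * q * (1 + x * suc q) ≡⟨ ℕ-Solver.solve (c ∷ q ∷ x ∷ []) ⟩
  (c + c * q * x) * suc q    ∎)
  where open ≡-Reasoning

∣c+i*d⇒∣c+[i%n]*d : ∀ {n} .{{_ : NonZero n}} c i d → n ∣ c + i * d → n ∣ c + (i % n) * d
∣c+i*d⇒∣c+[i%n]*d {n} c i d n∣c+id = ∣m+n∣m⇒∣n (subst (n ∣_) split n∣c+id) (n∣m*n (i / n * d))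
  where
  split : c + i * d ≡ i / n * d * n + (c + i % n * d)
  split = begin
    c + i * d                           ≡⟨ cong (λ z → c + z * d) (m≡m%n+[m/n]*n i n) ⟩
    c + (i % n + i / n * n) * d         ≡⟨ regroup c (i % n) (i / n) n d ⟩
    i / n * d * n + (c + i % n * d)     ∎
    where
    open ≡-Reasoning
    regroup : ∀ c r t n d → c + (r + t * n) * d ≡ t * d * n + (c + r * d)
    regroup = ℕ-Solver.solve-∀

coprime⇒∃i<n∣c+i*d : ∀ {n d} .{{_ : NonZero n}} → Coprime n d → ∀ c → ∃[ i ] i < n × n ∣ c + i * d
coprime⇒∃i<n∣c+i*d {n} {d} n⊥d c with coprime⇒∃i∣c+i*d n⊥d c
... | i , n∣c+id = i % n , m%n<n i n , ∣c+i*d⇒∣c+[i%n]*d c i d n∣c+id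

pairSum : ℕ → ℕ → ℤ
pairSum p s = if s <ᵇ p ∸ 1 then 0ℤ else + 2

pairSum-nonneg : ∀ p s → 0ℤ ℤ.≤ pairSum p s
pairSum-nonneg p s with s <ᵇ p ∸ 1
... | true  = ℤ.≤-refl
... | false = ℤ.+≤+ z≤n

pairSum[p∸1]≡2 : ∀ p → pairSum p (p ∸ 1) ≡ + 2
pairSum[p∸1]≡2 p rewrite m≥n⇒m<ᵇn≡false (≤-refl {p ∸ 1}) = refl

module _ (p : ℕ) .{{_ : NonZero p}} where

  private instance
    2p≢0 : NonZero (2 * p)
    2p≢0 = m*n≢0 2 p

  f-periodic : ∀ j t → f p (j + t * (2 * p)) ≡ f p j
  f-periodic j t = cong (λ r → if r <ᵇ p ∸ 1 then -1ℤ else 1ℤ) ([m+kn]%n≡m%n j t (2 * p))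

  f-±1 : ∀ j → f p j ≡ -1ℤ ⊎ f p j ≡ 1ℤ
  f-±1 j with j % (2 * p) <ᵇ p ∸ 1
  ... | true  = inj₁ refl
  ... | false = inj₂ refl

  f[s]+f[s+p]≡pairSum : ∀ {s} → s < p → f p s ℤ.+ f p (s + p) ≡ pairSum p s
  f[s]+f[s+p]≡pairSum {s} s<p = begin
    f p s ℤ.+ f p (s + p)                               ≡⟨ cong₂ ℤ._+_ f[s] f[s+p]≡1 ⟩
    (if s <ᵇ p ∸ 1 then -1ℤ else 1ℤ) ℤ.+ 1ℤ             ≡⟨ add-one (s <ᵇ p ∸ 1) ⟩
    pairSum p s                                         ∎
    where
    open ≡-Reasoning
    s+p<2p : s + p < 2 * p
    s+p<2p = subst (s + p <_) (cong (_+_ p) (sym (+-identityʳ p))) (+-monoˡ-< p s<p)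
    f[s] : f p s ≡ (if s <ᵇ p ∸ 1 then -1ℤ else 1ℤ)
    f[s] = cong (λ r → if r <ᵇ p ∸ 1 then -1ℤ else 1ℤ) (m<n⇒m%n≡m (<-≤-trans s<p (m≤m+n p (p + 0))))
    f[s+p]≡1 : f p (s + p) ≡ 1ℤ
    f[s+p]≡1 rewrite m<n⇒m%n≡m s+p<2p | m≥n⇒m<ᵇn≡false (≤-trans (m∸n≤m p 1) (m≤n+m p s)) = refl
    add-one : ∀ b → (if b then -1ℤ else 1ℤ) ℤ.+ 1ℤ ≡ (if b then 0ℤ else + 2)
    add-one true  = refl
    add-one false = refl

  f-pair : ∀ m {s} → s < p → f p (s + m * p) ℤ.+ f p (s + m * p + p) ≡ pairSum p s
  f-pair zero          {s} s<p rewrite +-identityʳ s = f[s]+f[s+p]≡pairSum s<p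
  f-pair (suc zero)    {s} s<p = begin
    f p (s + 1 * p) ℤ.+ f p (s + 1 * p + p)   ≡⟨ cong₂ ℤ._+_ (cong (λ x → f p (s + x)) (+-identityʳ p))
                                                            (trans (cong (f p) (one-period s p)) (f-periodic s 1)) ⟩
    f p (s + p) ℤ.+ f p s                     ≡⟨ ℤ.+-comm (f p (s + p)) (f p s) ⟩
    f p s ℤ.+ f p (s + p)                     ≡⟨ f[s]+f[s+p]≡pairSum s<p ⟩
    pairSum p s                               ∎
    where
    open ≡-Reasoning
    one-period : ∀ s p → s + 1 * p + p ≡ s + 1 * (2 * p)
    one-period = ℕ-Solver.solve-∀
  f-pair (suc (suc m)) {s} s<p = begin
    f p (s + 2+m * p) ℤ.+ f p (s + 2+m * p + p)   ≡⟨ cong₂ ℤ._+_ (trans (cong (f p) (two-periods s m p)) (f-periodic _ 1))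
                                                                (trans (cong (f p) (two-periods+p s m p)) (f-periodic _ 1)) ⟩
    f p (s + m * p) ℤ.+ f p (s + m * p + p)       ≡⟨ f-pair m s<p ⟩
    pairSum p s                                   ∎
    where
    open ≡-Reasoning
    2+m = suc (suc m)
    two-periods : ∀ s m p → s + (2 + m) * p ≡ s + m * p + 1 * (2 * p)
    two-periods = ℕ-Solver.solve-∀
    two-periods+p : ∀ s m p → s + (2 + m) * p + p ≡ s + m * p + p + 1 * (2 * p)
    two-periods+p = ℕ-Solver.solve-∀

  f[j]+f[j+p]≡pairSum : ∀ j → f p j ℤ.+ f p (j + p) ≡ pairSum p (j % p)
  f[j]+f[j+p]≡pairSum j =
    subst (λ x → f p x ℤ.+ f p (x + p) ≡ pairSum p (j % p)) (sym (m≡m%n+[m/n]*n j p)) (f-pair (j / p) (m%n<n j p))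

  sumTo-2p : ∀ g → sumTo (2 * p) g ≡ sumTo p g ℤ.+ sumTo p (λ i → g (p + i))
  sumTo-2p g = trans (cong (λ n → sumTo n g) (cong (_+_ p) (+-identityʳ p))) (sumTo-+ p p g)

  apSum-even : ∀ a e → sumTo (2 * p) (λ i → f p (a + i * (e * 2)))
                     ≡ sumTo p (λ i → f p (a + i * (e * 2))) ℤ.+ sumTo p (λ i → f p (a + i * (e * 2)))
  apSum-even a e = trans (sumTo-2p G) (cong (ℤ._+_ (sumTo p G)) (sumTo-cong p shift))
    where
    G : ℕ → ℤ
    G i = f p (a + i * (e * 2))
    halfway : ∀ a p i e → a + (p + i) * (e * 2) ≡ a + i * (e * 2) + e * (2 * p)
    halfway = ℕ-Solver.solve-∀
    shift : ∀ i → G (p + i) ≡ G i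
    shift i = trans (cong (f p) (halfway a p i e)) (f-periodic _ e)

  apSum-odd : ∀ a e → sumTo (2 * p) (λ i → f p (a + i * suc (e * 2)))
                    ≡ sumTo p (λ i → pairSum p ((a + i * suc (e * 2)) % p))
  apSum-odd a e = begin
    sumTo (2 * p) G                                       ≡⟨ sumTo-2p G ⟩
    sumTo p G ℤ.+ sumTo p (λ i → G (p + i))               ≡⟨ cong (ℤ._+_ (sumTo p G)) (sumTo-cong p shift) ⟩
    sumTo p G ℤ.+ sumTo p (λ i → f p (a + i * d + p))     ≡⟨ sumTo-distrib-+ p G (λ i → f p (a + i * d + p)) ⟨
    sumTo p (λ i → G i ℤ.+ f p (a + i * d + p))           ≡⟨ sumTo-cong p (λ i → f[j]+f[j+p]≡pairSum (a + i * d)) ⟩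
    sumTo p (λ i → pairSum p ((a + i * d) % p))           ∎
    where
    open ≡-Reasoning
    d = suc (e * 2)
    G : ℕ → ℤ
    G i = f p (a + i * d)
    halfway : ∀ a p i e → a + (p + i) * suc (e * 2) ≡ a + i * suc (e * 2) + p + e * (2 * p)
    halfway = ℕ-Solver.solve-∀
    shift : ∀ i → G (p + i) ≡ f p (a + i * d + p)
    shift i = trans (cong (f p) (halfway a p i e)) (f-periodic _ e)

  pairSum-ap-pos : ∀ a {d} → Coprime p d → 0ℤ ℤ.< sumTo p (λ i → pairSum p ((a + i * d) % p))
  pairSum-ap-pos a {d} p⊥d with coprime⇒∃i<n∣c+i*d p⊥d (suc a)
  ... | i , i<p , p∣1+a+id =
    sumTo-pos p _ (λ j → pairSum-nonneg p _) i<p (subst (0ℤ ℤ.<_) (sym pairSum≡2) (ℤ.+<+ (s≤s z≤n)))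
    where
    pairSum≡2 : pairSum p ((a + i * d) % p) ≡ + 2
    pairSum≡2 = trans (cong (pairSum p) (%-pred-≡0 (n∣m⇒m%n≡0 _ p p∣1+a+id))) (pairSum[p∸1]≡2 p)

proposition4p11 : (p : ℕ) → .{{_ : NonZero p}} → Prime p → p ≢ 2 →
    (a d : ℕ) → 1 ≤ d → a + (2 * p ∸ 1) * d < p ^ 2 ∸ 1 →
    sumTo (2 * p) (λ i → f p (a + i * d)) ≢ + 0
proposition4p11 p pr p≢2 a d _ bound apSum≡0 with even⊎odd d
... | e , inj₁ refl = p≢2 (prime∧2∣p⇒p≡2 pr 2∣p)
  where
  halfSum≡0 : sumTo p (λ i → f p (a + i * (e * 2))) ≡ 0ℤ
  halfSum≡0 = i+i≡0⇒i≡0 (trans (sym (apSum-even p a e)) apSum≡0)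
  2∣p : 2 ∣ p
  2∣p = sumTo-±1≡0⇒2∣m p _ (λ i → f-±1 p _) halfSum≡0
... | e , inj₂ refl = ℤ.<⇒≢ (pairSum-ap-pos p a p⊥d) (sym (trans (sym (apSum-odd p a e)) apSum≡0))
  where
  p⊥d : Coprime p (suc (e * 2))
  p⊥d = prime⇒coprime pr (m+[2n∸1]*d<n^2∸1⇒d<n a p _ bound)
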